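{- Let $G$ be a connected graph with $n$ vertices and $m$ edges, and let $t$ be an integer with $2\leq t\leq n-1$. If $\binom{n-t}{2}+t(n-t)\leq m\leq \binom{n-t}{2}+t(n-t)+(t-2)$, then $mc(G)\leq m-t+1$. Moreover, the bound is sharp: for all such $n,t,m$ there exists a connected graph with $n$ vertices and $m$ edges whose monochromatic connection number equals $m-t+1$.
   Context: All graphs are finite, simple and undirected. For a connected graph $G$, an edge-coloring of $G$ (adjacent edges may receive the same color) is a monochromatic connection coloring (MC-coloring) if any two vertices of $G$ are joined by a path all of whose edges have the same color. The monochromatic connection number $mc(G)$ is the maximum number of colors used in an MC-coloring of $G$. -}

module Defs where

open import Data.Nat using (ℕ; _≤_; _<_)
open import Data.Fin using (Fin; toℕ)
open import Data.Product using (_×_; _,_; proj₁; proj₂; Σ; ∃)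
open import Data.Sum using (_⊎_)
open import Data.Unit using (⊤)
open import Data.List using (List; []; _∷_)
open import Data.List.Relation.Unary.Unique.Propositional using (Unique)
open import Relation.Binary.PropositionalEquality using (_≡_)
open import Function.Definitions using (Injective; Surjective)

-- Edges are indexed by Fin m; edge e has endpoints (u , v) with u < v
-- (no loops, canonical orientation), and distinct indices give distinct
-- vertex pairs (no multi-edges).
record Graph (n m : ℕ) : Set where
  field
    ends    : Fin m → Fin n × Fin n
    ordered : ∀ e → toℕ (proj₁ (ends e)) < toℕ (proj₂ (ends e))
    simple  : Injective _≡_ _≡_ ends
open Graph public

Joins : ∀ {n m} → Graph n m → Fin m → Fin n → Fin n → Set
Joins G e x y = ends G e ≡ (x , y) ⊎ ends G e ≡ (y , x)

data Walk {n m} (G : Graph n m) (P : Fin m → Set) :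
     Fin n → Fin n → List (Fin n) → Set where
  nil  : ∀ {x} → Walk G P x x (x ∷ [])
  cons : ∀ {x y z vs} (e : Fin m) → P e → Joins G e x y →
         Walk G P y z vs → Walk G P x z (x ∷ vs)

Path : ∀ {n m} → Graph n m → (Fin m → Set) → Fin n → Fin n → Set
Path G P x y = ∃ λ vs → Walk G P x y vs × Unique vs

Connected : ∀ {n m} → Graph n m → Set
Connected G = ∀ x y → Path G (λ _ → ⊤) x y

IsMC : ∀ {n m k} → Graph n m → (Fin m → Fin k) → Set
IsMC {k = k} G c = ∀ x y → Σ (Fin k) λ col → Path G (λ e → c e ≡ col) x y

UsesAll : ∀ {m k} → (Fin m → Fin k) → Set
UsesAll c = Surjective _≡_ _≡_ c

mc≤ : ∀ {n m} → Graph n m → ℕ → Set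
mc≤ {m = m} G b = ∀ k (c : Fin m → Fin k) → UsesAll c → IsMC G c → k ≤ b

mc≡ : ∀ {n m} → Graph n m → ℕ → Set
mc≡ {m = m} G b =
  (Σ (Fin m → Fin b) λ c → UsesAll c × IsMC G c) × mc≤ G b

-- Let c be an MC-colouring of G with k colours, m_c edges of colour c, and
-- X = Σ_c (m_c - 1) = m - k.  The components of the colour-c subgraph have
-- sizes s_i with Σ_i (s_i - 1) ≤ m_c, so by convexity colour c joins at most
-- n + m_c (m_c + 1) ordered pairs (x , y).  Every vertex is joined to itself
-- in all k colours and to every other vertex in at least one; summing over
-- the colours and using convexity once more gives n (n - 1) ≤ 2m + X (X + 1).
-- When m ≤ C(n-t,2) + t(n-t) + t - 2 this forces X ≥ t - 1, i.e. k ≤ m - t + 1.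
--
-- Sharpness: take a star with centre 0 and leaves 1 … t, join every vertex
-- v > t to all smaller vertices, and add q = m - C(n-t,2) - t(n-t) ≤ t - 2
-- edges between leaves.  Colour the star with one colour and every other edge with
-- a colour of its own: two leaves are joined through the centre, and every
-- other pair of vertices is adjacent.
module Submission where

open import Defs
open import Data.Nat using (ℕ; _+_; _*_; _∸_; _≤_)
open import Data.Nat.Combinatorics using (_C_)
open import Data.Product using (_×_; Σ)

open import Data.Bool using (if_then_else_)
open import Data.Fin using (Fin; zero; suc; toℕ; fromℕ<; punchIn; splitAt; join; _↑ˡ_; _↑ʳ_)
open import Data.Fin.Properties
  using (_≟_; toℕ-injective; toℕ-fromℕ<; toℕ<n; splitAt-↑ˡ; splitAt-↑ʳ; join-splitAt)
open import Data.List using (List; []; _∷_; _++_; length; lookup; applyUpTo)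
open import Data.List.Membership.Propositional using (_∈_)
open import Data.List.Membership.Propositional.Properties
  using (∈-++⁺ˡ; ∈-++⁺ʳ; ∈-++⁻; ∈-applyUpTo⁺; ∈-applyUpTo⁻; ∈-lookup)
open import Data.List.Properties using (length-++; length-applyUpTo)
open import Data.List.Relation.Unary.All using ([]; _∷_)
import Data.List.Relation.Unary.All as All
open import Data.List.Relation.Unary.Any using (index)
open import Data.List.Relation.Unary.Any.Properties using (lookup-index)
open import Data.List.Relation.Unary.AllPairs using ([]; _∷_)
open import Data.List.Relation.Unary.Unique.Propositional using (Unique)
import Data.List.Relation.Unary.Unique.Propositional.Properties as Unique
open import Data.Nat using (zero; suc; z≤n; s≤s; z<s; _<_; _<?_)
open import Data.Nat.Combinatorics using (nC1≡n; nCk+nC[k+1]≡[n+1]C[k+1])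
open import Data.Nat.Properties hiding (_≟_)
open import Data.Nat.Tactic.RingSolver using (solve-∀)
open import Data.Product using (_,_; proj₁; proj₂; map₂)
open import Data.Sum using (_⊎_; inj₁; inj₂; [_,_])
open import Data.Vec.Functional using (removeAt)
open import Function using (_∘_; id; Injective)
open import Level using (0ℓ)
open import Relation.Binary.Definitions using (tri<; tri≈; tri>)
open import Relation.Binary.PropositionalEquality hiding ([_])
open import Relation.Nullary using (Dec; does; yes; no; ¬_; contradiction)
open import Relation.Nullary.Decidable using (dec-true; dec-false)
open import Relation.Unary using (Pred; Decidable)
open import Algebra.Properties.Semiring.Sum +-*-semiring
  using (sum; sum-syntax; sum-cong-≗; sum-remove; ∑-distrib-+; ∑-comm; *-distribʳ-sum)

∑-mono-≤ : ∀ {n} {f g : Fin n → ℕ} → (∀ i → f i ≤ g i) → sum f ≤ sum g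
∑-mono-≤ {zero}  _   = z≤n
∑-mono-≤ {suc n} f≤g = +-mono-≤ (f≤g zero) (∑-mono-≤ (f≤g ∘ suc))

∑-const : ∀ n c → ∑[ i < n ] c ≡ n * c
∑-const zero    c = refl
∑-const (suc n) c = cong (c +_) (∑-const n c)

∑-zero : ∀ n → ∑[ i < n ] 0 ≡ 0
∑-zero n = trans (∑-const n 0) (*-zeroʳ n)

∑-one : ∀ n → ∑[ i < n ] 1 ≡ n
∑-one n = trans (∑-const n 1) (*-identityʳ n)

term≤∑ : ∀ {n} (f : Fin n → ℕ) i → f i ≤ sum f
term≤∑ {suc n} f i = ≤-trans (m≤m+n (f i) _) (≤-reflexive (sym (sum-remove f)))

term+count≤∑ : ∀ {n} (f : Fin (suc n) → ℕ) i → (∀ j → 1 ≤ f j) → f i + n ≤ sum f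
term+count≤∑ {n} f i positive = begin
  f i + n                  ≡⟨ cong (f i +_) (sym (∑-one n)) ⟩
  f i + ∑[ j < n ] 1       ≤⟨ +-monoʳ-≤ (f i) (∑-mono-≤ (positive ∘ punchIn i)) ⟩
  f i + sum (removeAt f i) ≡⟨ sym (sum-remove f) ⟩
  sum f                    ∎
  where open ≤-Reasoning

𝟙 : ∀ {a} {A : Set a} → Dec A → ℕ
𝟙 a? = if does a? then 1 else 0

δ : ∀ {n} → Fin n → Fin n → ℕ
δ i j = 𝟙 (i ≟ j)

δ-refl : ∀ {n} (i : Fin n) → δ i i ≡ 1
δ-refl zero    = refl
δ-refl (suc i) = δ-refl i

δ-≢ : ∀ {n} {i j : Fin n} → i ≢ j → δ i j ≡ 0
δ-≢ {i = i} {j} i≢j = cong (if_then 1 else 0) (dec-false (i ≟ j) i≢j)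

δ-sym : ∀ {n} (i j : Fin n) → δ i j ≡ δ j i
δ-sym zero    zero    = refl
δ-sym zero    (suc j) = refl
δ-sym (suc i) zero    = refl
δ-sym (suc i) (suc j) = δ-sym i j

∑-δ* : ∀ {n} (i : Fin n) (f : Fin n → ℕ) → ∑[ j < n ] (δ i j * f j) ≡ f i
∑-δ* {suc n} zero    f =
  trans (cong₂ _+_ (+-identityʳ (f zero)) (∑-zero n)) (+-identityʳ (f zero))
∑-δ* {suc n} (suc i) f = ∑-δ* i (f ∘ suc)

∑-δ : ∀ {n} (i : Fin n) → ∑[ j < n ] δ i j ≡ 1
∑-δ i = trans (sum-cong-≗ (λ j → sym (*-identityʳ (δ i j)))) (∑-δ* i (λ _ → 1))

excess : ∀ {n} → (Fin n → ℕ) → ℕ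
excess {n} f = ∑[ i < n ] (f i ∸ 1)

excess+count : ∀ {n} (f : Fin n → ℕ) → (∀ i → 1 ≤ f i) → excess f + n ≡ sum f
excess+count {n} f positive = begin
  excess f + n             ≡⟨ cong (excess f +_) (sym (∑-one n)) ⟩
  excess f + ∑[ i < n ] 1  ≡⟨ sym (∑-distrib-+ (λ i → f i ∸ 1) (λ _ → 1)) ⟩
  ∑[ i < n ] (f i ∸ 1 + 1) ≡⟨ sum-cong-≗ (λ i → m∸n+n≡m (positive i)) ⟩
  sum f                    ∎
  where open ≡-Reasoning

∑-square≤ : ∀ {n} (f : Fin n → ℕ) →
  ∑[ i < n ] (f i * f i) ≤ sum f + excess f * suc (excess f)
∑-square≤ {zero}  f = z≤n
∑-square≤ {suc n} f = begin
  f zero * f zero + ∑[ i < n ] (f (suc i) * f (suc i))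
    ≤⟨ +-monoʳ-≤ (f zero * f zero) (∑-square≤ (f ∘ suc)) ⟩
  f zero * f zero + (sum (f ∘ suc) + X * suc X)
    ≡⟨ cong (_+ (sum (f ∘ suc) + X * suc X)) (square-excess (f zero)) ⟩
  f zero + x * suc x + (sum (f ∘ suc) + X * suc X)
    ≤⟨ superadditive (f zero) x (sum (f ∘ suc)) X ⟩
  f zero + sum (f ∘ suc) + (x + X) * suc (x + X) ∎
  where
  open ≤-Reasoning
  x = f zero ∸ 1
  X = excess (f ∘ suc)
  square-excess : ∀ a → a * a ≡ a + (a ∸ 1) * suc (a ∸ 1)
  square-excess zero    = refl
  square-excess (suc a) = solve-∀
  superadditive : ∀ a x s y →
    a + x * suc x + (s + y * suc y) ≤ a + s + (x + y) * suc (x + y)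
  superadditive a x s y = begin
    a + x * suc x + (s + y * suc y)               ≤⟨ m≤m+n _ (2 * (x * y)) ⟩
    a + x * suc x + (s + y * suc y) + 2 * (x * y) ≡⟨ expand a x s y ⟩
    a + s + (x + y) * suc (x + y)                 ∎
    where
    expand : ∀ a x s y →
      a + x * suc x + (s + y * suc y) + 2 * (x * y) ≡ a + s + (x + y) * suc (x + y)
    expand = solve-∀

-- Adding f p ∸ 1 at p on the left and f p at q on the right makes the
-- inequality pointwise.
excess-transfer : ∀ {n} {f g : Fin n → ℕ} {p q : Fin n} → p ≢ q →
  g p ≡ 0 → g q ≡ f q + f p → (∀ l → l ≢ p → l ≢ q → g l ≡ f l) →
  excess g ≤ suc (excess f)
excess-transfer {n} {f} {g} {p} {q} p≢q gp gq gl =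
  +-cancelʳ-≤ s (excess g) (suc (excess f)) (begin
    excess g + s                           ≡⟨ cong (excess g +_) (sym (∑-δ* p (λ _ → s))) ⟩
    excess g + ∑[ l < n ] (δ p l * s)      ≡⟨ sym (∑-distrib-+ (λ l → g l ∸ 1) _) ⟩
    ∑[ l < n ] (g l ∸ 1 + δ p l * s)       ≤⟨ ∑-mono-≤ pointwise ⟩
    ∑[ l < n ] ((f l ∸ 1) + δ q l * suc s) ≡⟨ ∑-distrib-+ (λ l → f l ∸ 1) _ ⟩
    excess f + ∑[ l < n ] (δ q l * suc s)  ≡⟨ cong (excess f +_) (∑-δ* q (λ _ → suc s)) ⟩
    excess f + suc s                       ≡⟨ +-suc (excess f) s ⟩
    suc (excess f) + s                     ∎)
  where
  open ≤-Reasoning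
  s = f p ∸ 1
  merged : ∀ a b → a + b ∸ 1 ≤ (a ∸ 1) + suc (b ∸ 1)
  merged zero    zero    = z≤n
  merged zero    (suc b) = n≤1+n b
  merged (suc a) zero    = ≤-trans (≤-reflexive (+-identityʳ a)) (m≤m+n a 1)
  merged (suc a) (suc b) = ≤-refl
  pointwise : ∀ l → g l ∸ 1 + δ p l * s ≤ (f l ∸ 1) + δ q l * suc s
  pointwise l with l ≟ q | l ≟ p
  ... | yes refl | _
      rewrite gq | δ-≢ p≢q | δ-refl q | +-identityʳ (f q + f p ∸ 1) | +-identityʳ (suc s)
      = merged (f q) (f p)
  ... | no l≢q | yes refl
      rewrite gp | δ-refl p | δ-≢ (l≢q ∘ sym)
      = ≤-refl
  ... | no l≢q | no l≢p
      rewrite gl l l≢p l≢q | δ-≢ (l≢p ∘ sym) | δ-≢ (l≢q ∘ sym)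
      = ≤-refl

-- A labelling encodes the partition of Fin n into classes of equal labels.
Labelling : ℕ → Set
Labelling n = Fin n → Fin n

classSize : ∀ {n} → Labelling n → Fin n → ℕ
classSize {n} L l = ∑[ x < n ] δ (L x) l

∑-classSize : ∀ {n} (L : Labelling n) → sum (classSize L) ≡ n
∑-classSize {n} L = begin
  ∑[ l < n ] ∑[ x < n ] δ (L x) l ≡⟨ sym (∑-comm (λ x l → δ (L x) l)) ⟩
  ∑[ x < n ] ∑[ l < n ] δ (L x) l ≡⟨ sum-cong-≗ (λ x → ∑-δ (L x)) ⟩
  ∑[ x < n ] 1                    ≡⟨ ∑-one n ⟩
  n                               ∎
  where open ≡-Reasoning

sameClassPairs≡∑square : ∀ {n} (L : Labelling n) →
  ∑[ x < n ] ∑[ y < n ] δ (L x) (L y) ≡ ∑[ l < n ] (classSize L l * classSize L l)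
sameClassPairs≡∑square {n} L = begin
  ∑[ x < n ] ∑[ y < n ] δ (L x) (L y)
    ≡⟨ sum-cong-≗ (λ x → sum-cong-≗ (λ y → δ-sym (L x) (L y))) ⟩
  ∑[ x < n ] classSize L (L x)
    ≡⟨ sum-cong-≗ (λ x → sym (∑-δ* (L x) (classSize L))) ⟩
  ∑[ x < n ] ∑[ l < n ] (δ (L x) l * classSize L l)
    ≡⟨ ∑-comm (λ x l → δ (L x) l * classSize L l) ⟩
  ∑[ l < n ] ∑[ x < n ] (δ (L x) l * classSize L l)
    ≡⟨ sum-cong-≗ (λ l → sym (*-distribʳ-sum (classSize L l) (λ x → δ (L x) l))) ⟩
  ∑[ l < n ] (classSize L l * classSize L l) ∎
  where open ≡-Reasoning

sameClassPairs≤ : ∀ {n} (L : Labelling n) →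
  ∑[ x < n ] ∑[ y < n ] δ (L x) (L y) ≤ n + excess (classSize L) * suc (excess (classSize L))
sameClassPairs≤ {n} L = begin
  ∑[ x < n ] ∑[ y < n ] δ (L x) (L y)        ≡⟨ sameClassPairs≡∑square L ⟩
  ∑[ l < n ] (classSize L l * classSize L l) ≤⟨ ∑-square≤ (classSize L) ⟩
  sum (classSize L) + X * suc X              ≡⟨ cong (_+ X * suc X) (∑-classSize L) ⟩
  n + X * suc X                              ∎
  where
  open ≤-Reasoning
  X = excess (classSize L)

excess-id : ∀ {n} → excess (classSize {n} id) ≡ 0
excess-id {n} = trans (sum-cong-≗ (λ l → cong (_∸ 1) (singleton l))) (∑-zero n)
  where
  singleton : ∀ l → classSize {n} id l ≡ 1
  singleton l = trans (sum-cong-≗ (λ x → δ-sym x l)) (∑-δ l)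

relabel : ∀ {n} → Fin n → Fin n → Fin n → Fin n
relabel p q y = if does (y ≟ p) then q else y

relabel-source : ∀ {n} (p q : Fin n) → relabel p q p ≡ q
relabel-source p q = cong (if_then q else p) (dec-true (p ≟ p) refl)

relabel-target : ∀ {n} (p q : Fin n) → relabel p q q ≡ q
relabel-target p q with q ≟ p
... | yes _ = refl
... | no _  = refl

relabel-self : ∀ {n} (p y : Fin n) → relabel p p y ≡ y
relabel-self p y with y ≟ p
... | yes y≡p = sym y≡p
... | no _    = refl

module _ {n} {p q : Fin n} (p≢q : p ≢ q) where

  δ-relabel-source : ∀ y → δ (relabel p q y) p ≡ 0
  δ-relabel-source y with y ≟ p
  ... | yes _  = δ-≢ (p≢q ∘ sym)
  ... | no y≢p = δ-≢ y≢p

  δ-relabel-target : ∀ y → δ (relabel p q y) q ≡ δ y q + δ y p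
  δ-relabel-target y with y ≟ p
  ... | yes refl = trans (δ-refl q) (cong (_+ 1) (sym (δ-≢ p≢q)))
  ... | no _     = sym (+-identityʳ _)

  δ-relabel-other : ∀ {l} → l ≢ p → l ≢ q → ∀ y → δ (relabel p q y) l ≡ δ y l
  δ-relabel-other l≢p l≢q y with y ≟ p
  ... | yes refl = trans (δ-≢ (l≢q ∘ sym)) (sym (δ-≢ (l≢p ∘ sym)))
  ... | no _     = refl

excess-relabel : ∀ {n} (p q : Fin n) (L : Labelling n) →
  excess (classSize (relabel p q ∘ L)) ≤ suc (excess (classSize L))
excess-relabel {n} p q L with p ≟ q
... | yes refl = ≤-trans (≤-reflexive unchanged) (n≤1+n _)
  where
  unchanged : excess (classSize (relabel p p ∘ L)) ≡ excess (classSize L)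
  unchanged = sum-cong-≗ λ l →
    cong (_∸ 1) (sum-cong-≗ λ x → cong (λ z → δ z l) (relabel-self p (L x)))
... | no p≢q = excess-transfer p≢q
  (trans (sum-cong-≗ (δ-relabel-source p≢q ∘ L)) (∑-zero n))
  (trans (sum-cong-≗ (δ-relabel-target p≢q ∘ L))
         (∑-distrib-+ (λ x → δ (L x) q) (λ x → δ (L x) p)))
  (λ l l≢p l≢q → sum-cong-≗ (δ-relabel-other p≢q l≢p l≢q ∘ L))

merge : ∀ {n} → Fin n × Fin n → Labelling n → Labelling n
merge (a , b) L = relabel (L b) (L a) ∘ L

merge-joins : ∀ {n} (a b : Fin n) (L : Labelling n) → merge (a , b) L a ≡ merge (a , b) L b
merge-joins a b L = trans (relabel-target (L b) (L a)) (sym (relabel-source (L b) (L a)))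

excess-merge : ∀ {n} (e : Fin n × Fin n) (L : Labelling n) →
  excess (classSize (merge e L)) ≤ suc (excess (classSize L))
excess-merge (a , b) L = excess-relabel (L b) (L a) L

count : ∀ {m} {P : Pred (Fin m) 0ℓ} → Decidable P → ℕ
count {m} P? = ∑[ e < m ] 𝟙 (P? e)

components : ∀ {n m} {P : Pred (Fin m) 0ℓ} → (Fin m → Fin n × Fin n) → Decidable P → Labelling n
components {m = zero}  E P? = id
components {m = suc m} E P? with P? zero
... | yes _ = merge (E zero) (components (E ∘ suc) (P? ∘ suc))
... | no  _ = components (E ∘ suc) (P? ∘ suc)

components-joins : ∀ {n m} {P : Pred (Fin m) 0ℓ} (E : Fin m → Fin n × Fin n) (P? : Decidable P) →
  ∀ e → P e → components E P? (proj₁ (E e)) ≡ components E P? (proj₂ (E e))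
components-joins {m = suc m} E P? e Pe with P? zero | e
... | yes _  | zero  = merge-joins (proj₁ (E zero)) (proj₂ (E zero)) (components (E ∘ suc) (P? ∘ suc))
... | yes _  | suc e = cong (relabel _ _) (components-joins (E ∘ suc) (P? ∘ suc) e Pe)
... | no ¬P0 | zero  = contradiction Pe ¬P0
... | no _   | suc e = components-joins (E ∘ suc) (P? ∘ suc) e Pe

excess-components : ∀ {n m} {P : Pred (Fin m) 0ℓ} (E : Fin m → Fin n × Fin n) (P? : Decidable P) →
  excess (classSize (components E P?)) ≤ count P?
excess-components {n} {zero}  E P? = ≤-reflexive (excess-id {n})
excess-components {m = suc m} E P? with P? zero
... | yes _ = ≤-trans (excess-merge (E zero) (components (E ∘ suc) (P? ∘ suc)))
                      (s≤s (excess-components (E ∘ suc) (P? ∘ suc)))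
... | no  _ = excess-components (E ∘ suc) (P? ∘ suc)

components-walk : ∀ {n m} (G : Graph n m) {P : Pred (Fin m) 0ℓ} (P? : Decidable P) {x z vs} →
  Walk G P x z vs → components (ends G) P? x ≡ components (ends G) P? z
components-walk G P? nil                    = refl
components-walk G P? (cons e Pe joins walk) = trans (endpoints joins) (components-walk G P? walk)
  where
  L = components (ends G) P?
  joined : L (proj₁ (ends G e)) ≡ L (proj₂ (ends G e))
  joined = components-joins (ends G) P? e Pe
  endpoints : ∀ {x y} → Joins G e x y → L x ≡ L y
  endpoints (inj₁ eq) = subst (λ (u , v) → L u ≡ L v) eq joined
  endpoints (inj₂ eq) = sym (subst (λ (u , v) → L u ≡ L v) eq joined)

∑∑-lower-bound : ∀ {n d} (f : Fin n → Fin n → ℕ) →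
  (∀ x → f x x ≡ d) → (∀ x y → 1 ≤ f x y) → n * (d + (n ∸ 1)) ≤ ∑[ x < n ] ∑[ y < n ] f x y
∑∑-lower-bound {zero}      f diag positive = z≤n
∑∑-lower-bound {suc n} {d} f diag positive = begin
  suc n * (d + n)                     ≡⟨ sym (∑-const (suc n) (d + n)) ⟩
  ∑[ x < suc n ] (d + n)              ≡⟨ sum-cong-≗ (λ x → cong (_+ n) (sym (diag x))) ⟩
  ∑[ x < suc n ] (f x x + n)          ≤⟨ ∑-mono-≤ (λ x → term+count≤∑ (f x) x (positive x)) ⟩
  ∑[ x < suc n ] ∑[ y < suc n ] f x y ∎
  where open ≤-Reasoning

-- Definitionally ∑[ e < m ] δ (c e) col.
colourClassSize : ∀ {m k} → (Fin m → Fin k) → Fin k → ℕ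
colourClassSize c col = count (λ e → c e ≟ col)

∑-colourClassSize : ∀ {m k} (c : Fin m → Fin k) → sum (colourClassSize c) ≡ m
∑-colourClassSize {m} {k} c = begin
  ∑[ col < k ] ∑[ e < m ] δ (c e) col ≡⟨ sym (∑-comm (λ e col → δ (c e) col)) ⟩
  ∑[ e < m ] ∑[ col < k ] δ (c e) col ≡⟨ sum-cong-≗ (λ e → ∑-δ (c e)) ⟩
  ∑[ e < m ] 1                        ≡⟨ ∑-one m ⟩
  m                                   ∎
  where open ≡-Reasoning

colourClassSize-positive : ∀ {m k} (c : Fin m → Fin k) → UsesAll c →
  ∀ col → 1 ≤ colourClassSize c col
colourClassSize-positive c surjective col with e , ce≡col ← surjective col = begin
  1                     ≡⟨ sym (δ-refl col) ⟩
  δ col col             ≡⟨ cong (λ z → δ z col) (sym (ce≡col refl)) ⟩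
  δ (c e) col           ≤⟨ term≤∑ (λ e → δ (c e) col) e ⟩
  colourClassSize c col ∎
  where open ≤-Reasoning

excess+colours : ∀ {m k} (c : Fin m → Fin k) → UsesAll c → excess (colourClassSize c) + k ≡ m
excess+colours c surjective =
  trans (excess+count _ (colourClassSize-positive c surjective)) (∑-colourClassSize c)

module _ {n m k} (G : Graph n m) (c : Fin m → Fin k) where

  colourComponents : Fin k → Labelling n
  colourComponents col = components (ends G) (λ e → c e ≟ col)

  excess-colourComponents : ∀ col →
    excess (classSize (colourComponents col)) ≤ colourClassSize c col
  excess-colourComponents col = excess-components (ends G) (λ e → c e ≟ col)

  sharedComponents : Fin n → Fin n → ℕ
  sharedComponents x y = ∑[ col < k ] δ (colourComponents col x) (colourComponents col y)

  sharedComponents-positive : IsMC G c → ∀ x y → 1 ≤ sharedComponents x y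
  sharedComponents-positive isMC x y with col , _ , walk , _ ← isMC x y = begin
    1                    ≡⟨ sym (δ-refl (L x)) ⟩
    δ (L x) (L x)        ≡⟨ cong (δ (L x)) (components-walk G (λ e → c e ≟ col) walk) ⟩
    δ (L x) (L y)        ≤⟨ term≤∑ (λ col → δ (colourComponents col x) (colourComponents col y)) col ⟩
    sharedComponents x y ∎
    where
    open ≤-Reasoning
    L = colourComponents col

  sharedComponents-diag : ∀ x → sharedComponents x x ≡ k
  sharedComponents-diag x = trans (sum-cong-≗ (λ col → δ-refl (colourComponents col x))) (∑-one k)

  ∑∑-sharedComponents≤ : let X = excess (colourClassSize c) in
    ∑[ x < n ] ∑[ y < n ] sharedComponents x y ≤ k * n + (m + (m + X * suc X))
  ∑∑-sharedComponents≤ = begin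
    ∑[ x < n ] ∑[ y < n ] ∑[ col < k ] same col x y
      ≡⟨ sum-cong-≗ (λ x → ∑-comm (λ y col → same col x y)) ⟩
    ∑[ x < n ] ∑[ col < k ] ∑[ y < n ] same col x y
      ≡⟨ ∑-comm (λ x col → ∑[ y < n ] same col x y) ⟩
    ∑[ col < k ] ∑[ x < n ] ∑[ y < n ] same col x y
      ≤⟨ ∑-mono-≤ (λ col → ≤-trans (sameClassPairs≤ (colourComponents col)) (pairs-of-colour col)) ⟩
    ∑[ col < k ] (n + e col * suc (e col))
      ≡⟨ ∑-distrib-+ (λ _ → n) (λ col → e col * suc (e col)) ⟩
    ∑[ col < k ] n + ∑[ col < k ] (e col * suc (e col))
      ≡⟨ cong₂ _+_ (∑-const k n)
                   (trans (sum-cong-≗ (λ col → *-suc (e col) (e col))) (∑-distrib-+ e _)) ⟩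
    k * n + (sum e + ∑[ col < k ] (e col * e col))
      ≤⟨ +-monoʳ-≤ (k * n) (+-monoʳ-≤ (sum e) (∑-square≤ e)) ⟩
    k * n + (sum e + (sum e + X * suc X))
      ≡⟨ cong (λ s → k * n + (s + (s + X * suc X))) (∑-colourClassSize c) ⟩
    k * n + (m + (m + X * suc X)) ∎
    where
    open ≤-Reasoning
    same : Fin k → Fin n → Fin n → ℕ
    same col x y = δ (colourComponents col x) (colourComponents col y)
    e = colourClassSize c
    X = excess e
    pairs-of-colour : ∀ col → let Y = excess (classSize (colourComponents col)) in
      n + Y * suc Y ≤ n + e col * suc (e col)
    pairs-of-colour col = +-monoʳ-≤ n
      (*-mono-≤ (excess-colourComponents col) (s≤s (excess-colourComponents col)))

  IsMC⇒pairs≤ : UsesAll c → IsMC G c →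
    let X = excess (colourClassSize c) in n * (n ∸ 1) ≤ 2 * m + X * suc X
  IsMC⇒pairs≤ surjective isMC = +-cancelˡ-≤ (n * k) (n * (n ∸ 1)) (2 * m + X * suc X) (begin
    n * k + n * (n ∸ 1)
      ≡⟨ sym (*-distribˡ-+ n k (n ∸ 1)) ⟩
    n * (k + (n ∸ 1))
      ≤⟨ ∑∑-lower-bound sharedComponents sharedComponents-diag (sharedComponents-positive isMC) ⟩
    ∑[ x < n ] ∑[ y < n ] sharedComponents x y
      ≤⟨ ∑∑-sharedComponents≤ ⟩
    k * n + (m + (m + X * suc X))
      ≡⟨ rearrange k n m (X * suc X) ⟩
    n * k + (2 * m + X * suc X) ∎)
    where
    open ≤-Reasoning
    X = excess (colourClassSize c)
    rearrange : ∀ k n m Y → k * n + (m + (m + Y)) ≡ n * k + (2 * m + Y)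
    rearrange = solve-∀

2*C2 : ∀ a → 2 * (suc a C 2) ≡ suc a * a
2*C2 zero    = refl
2*C2 (suc a) = begin
  2 * (suc (suc a) C 2)             ≡⟨ cong (2 *_) (sym (nCk+nC[k+1]≡[n+1]C[k+1] (suc a) 1)) ⟩
  2 * (suc a C 1 + suc a C 2)       ≡⟨ *-distribˡ-+ 2 (suc a C 1) (suc a C 2) ⟩
  2 * (suc a C 1) + 2 * (suc a C 2) ≡⟨ cong₂ (λ x y → 2 * x + y) (nC1≡n (suc a)) (2*C2 a) ⟩
  2 * suc a + suc a * a             ≡⟨ expand a ⟩
  suc (suc a) * suc a               ∎
  where
  open ≡-Reasoning
  expand : ∀ a → 2 * suc a + suc a * a ≡ suc (suc a) * suc a
  expand = solve-∀

few-edges⇒few-pairs : ∀ a u {m X} → m ≤ suc a C 2 + (2 + u) * suc a + u → X ≤ u →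
  2 * m + X * suc X < (suc a + (2 + u)) * (a + (2 + u))
few-edges⇒few-pairs a u {m} {X} m≤ X≤u = begin-strict
  2 * m + X * suc X
    ≤⟨ +-mono-≤ (*-monoʳ-≤ 2 m≤) (*-mono-≤ X≤u (s≤s X≤u)) ⟩
  2 * (suc a C 2 + (2 + u) * suc a + u) + u * suc u
    ≡⟨ distribute (suc a C 2) a u ⟩
  2 * (suc a C 2) + rest
    ≡⟨ cong (_+ rest) (2*C2 a) ⟩
  suc a * a + rest
    <⟨ m<m+n _ z<s ⟩
  suc a * a + rest + 2
    ≡⟨ square a u ⟩
  (suc a + (2 + u)) * (a + (2 + u)) ∎
  where
  open ≤-Reasoning
  rest = 2 * ((2 + u) * suc a) + 2 * u + u * suc u
  distribute : ∀ c a u →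
    2 * (c + (2 + u) * suc a + u) + u * suc u ≡ 2 * c + (2 * ((2 + u) * suc a) + 2 * u + u * suc u)
  distribute = solve-∀
  square : ∀ a u →
    suc a * a + (2 * ((2 + u) * suc a) + 2 * u + u * suc u) + 2 ≡ (suc a + (2 + u)) * (a + (2 + u))
  square = solve-∀

m∸n≤m∸[1+n]+1 : ∀ m n → m ∸ n ≤ m ∸ suc n + 1
m∸n≤m∸[1+n]+1 zero    zero    = z≤n
m∸n≤m∸[1+n]+1 zero    (suc n) = z≤n
m∸n≤m∸[1+n]+1 (suc m) zero    = ≤-reflexive (+-comm 1 m)
m∸n≤m∸[1+n]+1 (suc m) (suc n) = m∸n≤m∸[1+n]+1 m n

colours≤ : ∀ {m k X s} → X + k ≡ m → s ≤ X → k ≤ m ∸ suc s + 1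
colours≤ {m} {k} {X} {s} X+k≡m s≤X = begin
  k             ≡⟨ sym (trans (cong (_∸ X) (sym X+k≡m)) (m+n∸m≡n X k)) ⟩
  m ∸ X         ≤⟨ ∸-monoʳ-≤ m s≤X ⟩
  m ∸ s         ≤⟨ m∸n≤m∸[1+n]+1 m s ⟩
  m ∸ suc s + 1 ∎
  where open ≤-Reasoning

mc≤m∸t+1 : ∀ a u {m} → m ≤ suc a C 2 + (2 + u) * suc a + u →
  (G : Graph (suc a + (2 + u)) m) → mc≤ G (m ∸ (2 + u) + 1)
mc≤m∸t+1 a u m≤ G k c surjective isMC = colours≤ (excess+colours c surjective) large-excess
  where
  large-excess : suc u ≤ excess (colourClassSize c)
  large-excess = ≮⇒≥ λ X<1+u →
    <⇒≱ (few-edges⇒few-pairs a u m≤ (≤-pred X<1+u)) (IsMC⇒pairs≤ G c surjective isMC)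

lookup-injective : ∀ {A : Set} {xs : List A} → Unique xs → Injective _≡_ _≡_ (lookup xs)
lookup-injective (_  ∷ _) {zero}  {zero}  _  = refl
lookup-injective (x∉ ∷ _) {zero}  {suc j} eq = contradiction eq (All.lookup x∉ (∈-lookup j))
lookup-injective (x∉ ∷ _) {suc i} {zero}  eq = contradiction (sym eq) (All.lookup x∉ (∈-lookup i))
lookup-injective (_  ∷ u) {suc i} {suc j} eq = cong suc (lookup-injective u eq)

[,]∘splitAt-injective : ∀ {A : Set} s {l} {f : Fin s → A} {g : Fin l → A} →
  Injective _≡_ _≡_ f → Injective _≡_ _≡_ g → (∀ i j → f i ≢ g j) →
  Injective _≡_ _≡_ ([ f , g ] ∘ splitAt s)
[,]∘splitAt-injective s {l} {f} {g} f-inj g-inj f≢g {e} {e′} eq = begin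
  e                       ≡⟨ sym (join-splitAt s l e) ⟩
  join s l (splitAt s e)  ≡⟨ cong (join s l) (split (splitAt s e) (splitAt s e′) eq) ⟩
  join s l (splitAt s e′) ≡⟨ join-splitAt s l e′ ⟩
  e′                      ∎
  where
  open ≡-Reasoning
  split : ∀ a b → [ f , g ] a ≡ [ f , g ] b → a ≡ b
  split (inj₁ i) (inj₁ j) eq = cong inj₁ (f-inj eq)
  split (inj₁ i) (inj₂ j) eq = contradiction eq (f≢g i j)
  split (inj₂ i) (inj₁ j) eq = contradiction (sym eq) (f≢g j i)
  split (inj₂ i) (inj₂ j) eq = cong inj₂ (g-inj eq)

Bounded : ℕ → ℕ × ℕ → Set
Bounded n p = proj₁ p < proj₂ p × proj₂ p < n

toℕ² : ∀ {n} → Fin n × Fin n → ℕ × ℕ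
toℕ² (x , y) = toℕ x , toℕ y

toℕ²-injective : ∀ {n} → Injective _≡_ _≡_ (toℕ² {n})
toℕ²-injective eq = cong₂ _,_ (toℕ-injective (cong proj₁ eq)) (toℕ-injective (cong proj₂ eq))

module _ {n m} (edge : Fin m → ℕ × ℕ) (bounded : ∀ e → Bounded n (edge e))
         (edge-injective : Injective _≡_ _≡_ edge) where

  private
    endpoints : Fin m → Fin n × Fin n
    endpoints e = fromℕ< (<-trans x<y y<n) , fromℕ< y<n
      where
      x<y = proj₁ (bounded e)
      y<n = proj₂ (bounded e)

    toℕ²-endpoints : ∀ e → toℕ² (endpoints e) ≡ edge e
    toℕ²-endpoints e = cong₂ _,_ (toℕ-fromℕ< _) (toℕ-fromℕ< _)

  pairGraph : Graph n m
  pairGraph = record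
    { ends    = endpoints
    ; ordered = λ e → subst₂ _<_ (sym (toℕ-fromℕ< _)) (sym (toℕ-fromℕ< _)) (proj₁ (bounded e))
    ; simple  = λ eq → edge-injective
                  (trans (sym (toℕ²-endpoints _)) (trans (cong toℕ² eq) (toℕ²-endpoints _)))
    }

  ends-pairGraph : ∀ e {x y} → edge e ≡ toℕ² (x , y) → ends pairGraph e ≡ (x , y)
  ends-pairGraph e eq = toℕ²-injective (trans (toℕ²-endpoints e) eq)

module _ {n m} (G : Graph n m) where

  Walk-map : ∀ {P Q : Fin m → Set} → (∀ {e} → P e → Q e) →
    ∀ {x y vs} → Walk G P x y vs → Walk G Q x y vs
  Walk-map P⇒Q nil                 = nil
  Walk-map P⇒Q (cons e Pe joins w) = cons e (P⇒Q Pe) joins (Walk-map P⇒Q w)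

  IsMC⇒Connected : ∀ {k} {c : Fin m → Fin k} → IsMC G c → Connected G
  IsMC⇒Connected isMC x y with _ , vs , walk , unique ← isMC x y = vs , Walk-map _ walk , unique

  edgePath : ∀ {k} (c : Fin m → Fin k) {x y} e →
    Joins G e x y → x ≢ y → Path G (λ e′ → c e′ ≡ c e) x y
  edgePath c e joins x≢y = _ , cons e refl joins nil , (x≢y ∷ []) ∷ [] ∷ []

blocks : ℕ → ℕ → List (ℕ × ℕ)
blocks t zero    = []
blocks t (suc r) = blocks t r ++ applyUpTo (λ x → x , t + suc r) (t + suc r)

∈-blocks⁻ : ∀ t r {p} → p ∈ blocks t r → proj₁ p < proj₂ p × t < proj₂ p × proj₂ p ≤ t + r
∈-blocks⁻ t (suc r) p∈ with ∈-++⁻ (blocks t r) p∈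
... | inj₁ p∈old with x<v , t<v , v≤t+r ← ∈-blocks⁻ t r p∈old =
  x<v , t<v , ≤-trans v≤t+r (+-monoʳ-≤ t (n≤1+n r))
... | inj₂ p∈new with x , x<v , refl ← ∈-applyUpTo⁻ _ p∈new =
  x<v , m<m+n t z<s , ≤-refl

∈-blocks⁺ : ∀ t r {x v} → x < v → t < v → v ≤ t + r → (x , v) ∈ blocks t r
∈-blocks⁺ t zero    x<v t<v v≤t+0 =
  contradiction (≤-trans t<v (≤-trans v≤t+0 (≤-reflexive (+-identityʳ t)))) (<-irrefl refl)
∈-blocks⁺ t (suc r) x<v t<v v≤t+r+1 with m≤n⇒m<n∨m≡n v≤t+r+1
... | inj₁ v<t+r+1 =
  ∈-++⁺ˡ (∈-blocks⁺ t r x<v t<v (≤-pred (≤-trans v<t+r+1 (≤-reflexive (+-suc t r)))))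
... | inj₂ refl = ∈-++⁺ʳ (blocks t r) (∈-applyUpTo⁺ (λ x → x , t + suc r) x<v)

blocks-unique : ∀ t r → Unique (blocks t r)
blocks-unique t zero    = []
blocks-unique t (suc r) = Unique.++⁺ (blocks-unique t r)
  (Unique.applyUpTo⁺₁ _ (t + suc r) (λ i<j _ eq → <-irrefl (cong proj₁ eq) i<j))
  (λ (p∈old , p∈new) → old∉new p∈old p∈new)
  where
  old∉new : ∀ {p} → p ∈ blocks t r → ¬ p ∈ applyUpTo (λ x → x , t + suc r) (t + suc r)
  old∉new p∈old p∈new with _ , _ , refl ← ∈-applyUpTo⁻ _ p∈new =
    <-irrefl refl (≤-trans (≤-reflexive (sym (+-suc t r))) (proj₂ (proj₂ (∈-blocks⁻ t r p∈old))))

length-blocks : ∀ t r → t + length (blocks t r) ≡ suc r C 2 + t * suc r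
length-blocks t zero    = trans (+-identityʳ t) (sym (*-identityʳ t))
length-blocks t (suc r) = begin
  t + length (blocks t r ++ new)
    ≡⟨ cong (t +_) (length-++ (blocks t r)) ⟩
  t + (length (blocks t r) + length new)
    ≡⟨ cong (λ l → t + (length (blocks t r) + l)) (length-applyUpTo _ (t + suc r)) ⟩
  t + (length (blocks t r) + (t + suc r))
    ≡⟨ sym (+-assoc t _ _) ⟩
  t + length (blocks t r) + (t + suc r)
    ≡⟨ cong (_+ (t + suc r)) (length-blocks t r) ⟩
  suc r C 2 + t * suc r + (t + suc r)
    ≡⟨ regroup (suc r C 2) t r ⟩
  (suc r + suc r C 2) + t * suc (suc r)
    ≡⟨ cong (λ c → (c + suc r C 2) + t * suc (suc r)) (sym (nC1≡n (suc r))) ⟩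
  (suc r C 1 + suc r C 2) + t * suc (suc r)
    ≡⟨ cong (_+ t * suc (suc r)) (nCk+nC[k+1]≡[n+1]C[k+1] (suc r) 1) ⟩
  suc (suc r) C 2 + t * suc (suc r) ∎
  where
  open ≡-Reasoning
  new = applyUpTo (λ x → x , t + suc r) (t + suc r)
  regroup : ∀ c t r → c + t * suc r + (t + suc r) ≡ (suc r + c) + t * suc (suc r)
  regroup = solve-∀

MCColouredGraph : ℕ → ℕ → ℕ → Set
MCColouredGraph n m k =
  Σ (Graph n m) λ G → Connected G × Σ (Fin m → Fin k) λ c → UsesAll c × IsMC G c

-- Vertex 0 is the centre, 1 … t are the leaves and t + 1 … t + a the other
-- vertices.
module ExtremalGraph (t a q : ℕ) (q<t : q < t) where

  leafEdges others : List (ℕ × ℕ)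
  leafEdges = applyUpTo (λ j → 1 , 2 + j) q
  others    = leafEdges ++ blocks t a

  t<n : t < suc a + t
  t<n = m<n+m t z<s

  ∈-others⁻ : ∀ {p} → p ∈ others → Bounded (suc a + t) p × (proj₁ p ≡ 1 ⊎ t < proj₂ p)
  ∈-others⁻ p∈ with ∈-++⁻ leafEdges p∈
  ... | inj₁ p∈leaf with j , j<q , refl ← ∈-applyUpTo⁻ _ p∈leaf =
    (s≤s z<s , ≤-<-trans (≤-trans (s≤s j<q) q<t) t<n) , inj₁ refl
  ... | inj₂ p∈blocks with x<v , t<v , v≤t+a ← ∈-blocks⁻ t a p∈blocks =
    (x<v , s≤s (≤-trans v≤t+a (≤-reflexive (+-comm t a)))) , inj₂ t<v

  others-unique : Unique others
  others-unique = Unique.++⁺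
    (Unique.applyUpTo⁺₁ _ q (λ i<j _ eq → <-irrefl (suc-injective (suc-injective (cong proj₂ eq))) i<j))
    (blocks-unique t a)
    (λ (p∈leaf , p∈blocks) → leaf∉blocks p∈leaf p∈blocks)
    where
    leaf∉blocks : ∀ {p} → p ∈ leafEdges → ¬ p ∈ blocks t a
    leaf∉blocks p∈leaf p∈blocks with j , j<q , refl ← ∈-applyUpTo⁻ _ p∈leaf =
      <⇒≱ (proj₁ (proj₂ (∈-blocks⁻ t a p∈blocks))) (≤-trans (s≤s j<q) q<t)

  star : Fin t → ℕ × ℕ
  star j = 0 , suc (toℕ j)

  m : ℕ
  m = t + length others

  edge : Fin m → ℕ × ℕ
  edge = [ star , lookup others ] ∘ splitAt t

  edge-bounded : ∀ e → Bounded (suc a + t) (edge e)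
  edge-bounded e with splitAt t e
  ... | inj₁ j = z<s , ≤-<-trans (toℕ<n j) t<n
  ... | inj₂ i = proj₁ (∈-others⁻ (∈-lookup i))

  edge-injective : Injective _≡_ _≡_ edge
  edge-injective = [,]∘splitAt-injective t
    (λ eq → toℕ-injective (suc-injective (cong proj₂ eq)))
    (lookup-injective others-unique)
    star≢other
    where
    star≢other : ∀ j i → star j ≢ lookup others i
    star≢other j i eq
      with subst (λ p → proj₁ p ≡ 1 ⊎ t < proj₂ p) (sym eq) (proj₂ (∈-others⁻ (∈-lookup i)))
    ... | inj₁ ()
    ... | inj₂ t<j+1 = <⇒≱ t<j+1 (toℕ<n j)

  G : Graph (suc a + t) m
  G = pairGraph edge edge-bounded edge-injective

  colouring : Fin m → Fin (suc (length others))
  colouring = [ (λ _ → zero) , suc ] ∘ splitAt t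

  colouring-surjective : UsesAll colouring
  colouring-surjective zero    =
    centre ↑ˡ length others , λ { refl → cong [ (λ _ → zero) , suc ] (splitAt-↑ˡ t centre _) }
    where
    centre : Fin t
    centre = fromℕ< (≤-trans (s≤s z≤n) q<t)
  colouring-surjective (suc i) =
    t ↑ʳ i , λ { refl → cong [ (λ _ → zero) , suc ] (splitAt-↑ʳ t _ i) }

  Leaf : Fin (suc a + t) → Set
  Leaf x = 1 ≤ toℕ x × toℕ x ≤ t

  leaf≢centre : ∀ {x} → Leaf x → x ≢ zero
  leaf≢centre (1≤x , _) refl = contradiction 1≤x λ ()

  starEdge : ∀ {x} → Leaf x → Σ (Fin m) λ e → ends G e ≡ (zero , x) × colouring e ≡ zero
  starEdge {suc x} (_ , x<t) =
    j ↑ˡ length others ,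
    ends-pairGraph edge edge-bounded edge-injective _
      (trans (cong [ star , lookup others ] (splitAt-↑ˡ t j _)) (cong (λ z → 0 , suc z) (toℕ-fromℕ< x<t))) ,
    cong [ (λ _ → zero) , suc ] (splitAt-↑ˡ t j _)
    where
    j : Fin t
    j = fromℕ< x<t

  otherEdge : ∀ {x y} → toℕ² (x , y) ∈ others → Σ (Fin m) λ e → ends G e ≡ (x , y)
  otherEdge p∈ =
    t ↑ʳ index p∈ ,
    ends-pairGraph edge edge-bounded edge-injective _
      (trans (cong [ star , lookup others ] (splitAt-↑ʳ t _ (index p∈))) (sym (lookup-index p∈)))

  adjacent-or-leaves : ∀ x y → toℕ x < toℕ y →
    (Σ (Fin m) λ e → ends G e ≡ (x , y)) ⊎ (Leaf x × Leaf y)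
  adjacent-or-leaves x y x<y with t <? toℕ y
  ... | yes t<y = inj₁ (otherEdge (∈-++⁺ʳ leafEdges (∈-blocks⁺ t a x<y t<y y≤t+a)))
    where
    y≤t+a : toℕ y ≤ t + a
    y≤t+a = ≤-trans (≤-pred (toℕ<n y)) (≤-reflexive (+-comm a t))
  ... | no t≮y with x
  ...   | zero  = inj₁ (map₂ proj₁ (starEdge (x<y , ≮⇒≥ t≮y)))
  ...   | suc _ = inj₂ ((s≤s z≤n , ≤-trans (<⇒≤ x<y) y≤t) , (≤-trans (s≤s z≤n) x<y , y≤t))
    where
    y≤t : toℕ y ≤ t
    y≤t = ≮⇒≥ t≮y

  centrePath : ∀ {x y} → Leaf x → Leaf y → x ≢ y → Path G (λ e → colouring e ≡ zero) x y
  centrePath {x} {y} leaf-x leaf-y x≢y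
    with ex , ex-ends , cx ← starEdge leaf-x | ey , ey-ends , cy ← starEdge leaf-y =
    x ∷ zero ∷ y ∷ [] ,
    cons ex cx (inj₂ ex-ends) (cons ey cy (inj₁ ey-ends) nil) ,
    (leaf≢centre leaf-x ∷ x≢y ∷ []) ∷ (leaf≢centre leaf-y ∘ sym ∷ []) ∷ [] ∷ []

  isMC : IsMC G colouring
  isMC x y with <-cmp (toℕ x) (toℕ y)
  ... | tri≈ _ x≡y _ rewrite toℕ-injective x≡y = zero , _ , nil , [] ∷ []
  ... | tri< x<y _ _ with adjacent-or-leaves x y x<y
  ...   | inj₁ (e , eq) = colouring e , edgePath G colouring e (inj₁ eq) (<⇒≢ x<y ∘ cong toℕ)
  ...   | inj₂ (leaf-x , leaf-y) = zero , centrePath leaf-x leaf-y (<⇒≢ x<y ∘ cong toℕ)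
  isMC x y | tri> _ _ y<x with adjacent-or-leaves y x y<x
  ...   | inj₁ (e , eq) = colouring e , edgePath G colouring e (inj₂ eq) (>⇒≢ y<x ∘ cong toℕ)
  ...   | inj₂ (leaf-y , leaf-x) = zero , centrePath leaf-x leaf-y (>⇒≢ y<x ∘ cong toℕ)

  length-edges : m ≡ suc a C 2 + t * suc a + q
  length-edges = begin
    t + length (leafEdges ++ blocks t a)
      ≡⟨ cong (t +_) (length-++ leafEdges) ⟩
    t + (length leafEdges + length (blocks t a))
      ≡⟨ cong (λ l → t + (l + length (blocks t a))) (length-applyUpTo _ q) ⟩
    t + (q + length (blocks t a))
      ≡⟨ regroup t q (length (blocks t a)) ⟩
    t + length (blocks t a) + q
      ≡⟨ cong (_+ q) (length-blocks t a) ⟩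
    suc a C 2 + t * suc a + q ∎
    where
    open ≡-Reasoning
    regroup : ∀ t q l → t + (q + l) ≡ t + l + q
    regroup = solve-∀

  colours : m ∸ t + 1 ≡ suc (length others)
  colours = trans (cong (_+ 1) (m+n∸m≡n t (length others))) (+-comm (length others) 1)

  witness : MCColouredGraph (suc a + t) m (m ∸ t + 1)
  witness = G , IsMC⇒Connected G isMC ,
    subst (λ k → Σ (Fin m → Fin k) λ c → UsesAll c × IsMC G c) (sym colours)
          (colouring , colouring-surjective , isMC)

SharpMCBound : ℕ → ℕ → ℕ → Set
SharpMCBound n m b =
  ((G : Graph n m) → Connected G → mc≤ G b) × (Σ (Graph n m) λ G → Connected G × mc≡ G b)

sharp-bound : ∀ a u m →
  suc a C 2 + (2 + u) * suc a ≤ m → m ≤ suc a C 2 + (2 + u) * suc a + u →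
  SharpMCBound (suc a + (2 + u)) m (m ∸ (2 + u) + 1)
sharp-bound a u m lower upper =
  (λ G _ → mc≤m∸t+1 a u upper G) ,
  attained (subst (λ m → MCColouredGraph (suc a + t) m (m ∸ t + 1)) edges
                  (ExtremalGraph.witness t a q q<t))
  where
  t = 2 + u
  base = suc a C 2 + t * suc a
  q = m ∸ base
  q<t : q < t
  q<t = s≤s (m≤n⇒m≤1+n (≤-trans (∸-monoˡ-≤ base upper) (≤-reflexive (m+n∸m≡n base u))))
  edges : ExtremalGraph.m t a q q<t ≡ m
  edges = trans (ExtremalGraph.length-edges t a q q<t) (m+[n∸m]≡n lower)
  attained : MCColouredGraph (suc a + t) m (m ∸ t + 1) →
    Σ (Graph (suc a + t) m) λ G → Connected G × mc≡ G (m ∸ t + 1)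
  attained (G , connected , colouring) = G , connected , colouring , mc≤m∸t+1 a u upper G

lemma5 : (n m t : ℕ) → 2 ≤ t → t ≤ n ∸ 1 →
    ((n ∸ t) C 2) + t * (n ∸ t) ≤ m →
    m ≤ ((n ∸ t) C 2) + t * (n ∸ t) + (t ∸ 2) →
    ((G : Graph n m) → Connected G → mc≤ G (m ∸ t + 1))
    × (Σ (Graph n m) λ G → Connected G × mc≡ G (m ∸ t + 1))
lemma5 _       _ 0 () _ _ _
lemma5 _       _ 1 (s≤s ()) _ _ _
lemma5 zero    _ (suc (suc u)) _ () _ _
lemma5 (suc n) m t@(suc (suc u)) _ t≤n lower upper with suc n ∸ t | +-∸-assoc 1 t≤n
... | .(suc (n ∸ t)) | refl =
  subst (λ n → SharpMCBound n m (m ∸ t + 1)) (cong suc (m∸n+n≡m t≤n))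
        (sharp-bound (n ∸ t) u m lower upper)
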